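{- Let $G$ be a simple graph, $k\ge1$, and let $\overrightarrow{G}^{(k)}_1$ and $\overrightarrow{G}^{(k)}_2$ be two oriented graphs obtained from $G$ by the construction described in the context. Then $\overrightarrow{G}^{(k)}_1$ and $\overrightarrow{G}^{(k)}_2$ are push equivalent.
   Context: Construction: given a simple graph $G$ and $k\ge1$, an oriented graph $\overrightarrow{G}^{(k)}$ is obtained by keeping the vertices of $G$ and replacing each edge $uv$ of $G$ by two internally disjoint oriented paths $\overrightarrow{P}$ and $\overrightarrow{P'}$ between $u$ and $v$, each of length $4k$ with new internal vertices, such that, traversing from $u$ to $v$, the number of forward arcs (arcs oriented in the traversal direction) is even in $\overrightarrow{P}$ and odd in $\overrightarrow{P'}$. (The internal vertices of the two constructions are identified in the natural way so both are orientations of the same graph.) To push a vertex is to reverse all arcs incident to it; pushing a set pushes each vertex once; push equivalent means obtainable from each other by pushing a vertex set. -}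

module Defs where

open import Data.Nat using (ℕ; zero; suc; _+_; _*_; _∸_; _<?_; _%_)
open import Data.Bool using (Bool; true; false; if_then_else_)
open import Data.Fin as Fin using (Fin; toℕ; fromℕ<)
open import Data.Product using (Σ; Σ-syntax; _×_; _,_; proj₁; proj₂)
open import Data.Sum using (_⊎_; inj₁; inj₂)
open import Relation.Nullary using (yes; no; ¬_)
open import Relation.Binary.PropositionalEquality using (_≡_; _≢_)
open import Function.Bundles using (_⇔_)

record SimpleGraph (n : ℕ) : Set where
  field
    Adj    : Fin n → Fin n → Bool
    sym    : ∀ u v → Adj u v ≡ Adj v u
    irrefl : ∀ u → Adj u u ≡ false
open SimpleGraph public

Edge : ∀ {n} → SimpleGraph n → Set
Edge {n} G = Σ[ u ∈ Fin n ] Σ[ v ∈ Fin n ] (u Fin.< v × Adj G u v ≡ true)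

src tgt : ∀ {n} {G : SimpleGraph n} → Edge G → Fin n
src (u , _) = u
tgt (_ , v , _) = v

countTrue : ∀ {m} → (Fin m → Bool) → ℕ
countTrue {zero} f = 0
countTrue {suc m} f = (if f Fin.zero then 1 else 0) + countTrue (λ i → f (Fin.suc i))

-- Vertices of the underlying graph of G^(k): the original vertices plus, for every
-- edge e of G and each of its two paths p (false = P, true = P'), the 4k-1
-- internal vertices of that path (internal position i+1 encoded by i : Fin (4k-1)).
Vtx : ∀ {n} → SimpleGraph n → ℕ → Set
Vtx {n} G k = Fin n ⊎ (Edge G × Bool × Fin (4 * k ∸ 1))

-- The vertex at position i (0 ≤ i ≤ 4k) along path p of edge e, traversed from
-- src e (position 0) to tgt e (position 4k).
pos : ∀ {n} (G : SimpleGraph n) (k : ℕ) → Edge G → Bool → ℕ → Vtx G k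
pos G k e p zero = inj₁ (src {G = G} e)
pos G k e p (suc i) with i <? 4 * k ∸ 1
... | yes i<L = inj₂ (e , p , fromℕ< i<L)
... | no  _   = inj₁ (tgt {G = G} e)

-- Orientation data of a construction G^(k): for every edge e, path p and arc index
-- j < 4k (the arc between positions j and j+1), whether the arc is forward, i.e.
-- oriented from position j to position j+1 (in the traversal from src e to tgt e).
Orientation : ∀ {n} → SimpleGraph n → ℕ → Set
Orientation G k = Edge G → Bool → Fin (4 * k) → Bool

IsConstruction : ∀ {n} (G : SimpleGraph n) (k : ℕ) → Orientation G k → Set
IsConstruction G k O =
  ∀ e → (countTrue (O e false) % 2 ≡ 0) × (countTrue (O e true) % 2 ≡ 1)

Arc : ∀ {n} (G : SimpleGraph n) (k : ℕ) → Orientation G k → Vtx G k → Vtx G k → Set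
Arc G k O x y =
  Σ[ e ∈ Edge G ] Σ[ p ∈ Bool ] Σ[ j ∈ Fin (4 * k) ]
    ( (O e p j ≡ true  × x ≡ pos G k e p (toℕ j) × y ≡ pos G k e p (suc (toℕ j)))
    ⊎ (O e p j ≡ false × x ≡ pos G k e p (suc (toℕ j)) × y ≡ pos G k e p (toℕ j)))

-- Pushing a vertex set S (given by its indicator): each vertex of S is pushed once, so an
-- arc is reversed iff exactly one of its endpoints lies in S.
Push : ∀ {V : Set} → (V → Bool) → (V → V → Set) → V → V → Set
Push S A x y = (S x ≡ S y × A x y) ⊎ (S x ≢ S y × A y x)

PushEquivalent : ∀ {V : Set} → (V → V → Set) → (V → V → Set) → Set
PushEquivalent {V} A B = Σ[ S ∈ (V → Bool) ] (∀ x y → B x y ⇔ Push S A x y)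

-- Push the internal vertex at position m of a path exactly when the two orientations
-- disagree on an odd number of the first m arcs of that path. An arc then gets reversed
-- precisely when the orientations disagree on it, since the prefix parities at its two ends
-- differ exactly then. The original vertices of G are not pushed; this is consistent at the
-- far end of each path because the construction fixes the parity of the number of forward
-- arcs on every path, so the two orientations disagree on an even number of its arcs.
module Submission where

open import Defs hiding (sym)
open import Data.Nat using (ℕ; zero; suc; _*_; _∸_; _≤_; _<_; _<?_; _%_; _≡ᵇ_; s≤s)
open import Data.Nat.Properties using (≮⇒≥; ≤-antisym)
open import Data.Bool using (Bool; true; false; not; _xor_)
open import Data.Bool.Properties
  using (_≟_; not-involutive; not-injective; ¬-not; xor-assoc; xor-comm; xor-same;
         xor-identityʳ; xor-inverseˡ; xor-∧-commutativeRing)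
open import Algebra.Bundles using (CommutativeRing)
open import Algebra.Properties.CommutativeSemigroup
  (CommutativeRing.+-commutativeSemigroup xor-∧-commutativeRing)
  using () renaming (interchange to xor-interchange)
open import Data.Fin as Fin using (Fin; toℕ)
open import Data.Fin.Properties using (toℕ<n; toℕ≤n; toℕ-fromℕ<)
open import Data.Product using (Σ; _×_; _,_; proj₁; proj₂)
open import Data.Sum using (_⊎_; inj₁; inj₂)
open import Relation.Nullary using (yes; no; ¬_)
open import Relation.Binary.PropositionalEquality
  using (_≡_; _≢_; refl; sym; trans; cong; cong₂; ≢-sym; module ≡-Reasoning)
open import Function.Bundles using (_⇔_; mk⇔; Equivalence)

open ≡-Reasoning

xor-cancelˡ : ∀ a b → a xor (a xor b) ≡ b
xor-cancelˡ a b = begin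
  a xor (a xor b)  ≡⟨ xor-assoc a a b ⟨
  (a xor a) xor b  ≡⟨ cong (_xor b) (xor-same a) ⟩
  b                ∎

xor-≢ : ∀ {a b} → a ≢ b → a xor b ≡ true
xor-≢ {a} {b} a≢b = trans (cong (_xor b) (¬-not a≢b)) (xor-inverseˡ b)

odd : ℕ → Bool
odd zero    = false
odd (suc n) = not (odd n)

odd≡%2≡ᵇ1 : ∀ n → odd n ≡ (n % 2 ≡ᵇ 1)
odd≡%2≡ᵇ1 zero          = refl
odd≡%2≡ᵇ1 (suc zero)    = refl
odd≡%2≡ᵇ1 (suc (suc n)) = trans (not-involutive (odd n)) (odd≡%2≡ᵇ1 n)

odd-cong-%2 : ∀ m n → m % 2 ≡ n % 2 → odd m ≡ odd n
odd-cong-%2 m n eq =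
  trans (odd≡%2≡ᵇ1 m) (trans (cong (_≡ᵇ 1) eq) (sym (odd≡%2≡ᵇ1 n)))

prefixXor : ∀ {N} → (Fin N → Bool) → ℕ → Bool
prefixXor         f zero    = false
prefixXor {zero}  f (suc m) = false
prefixXor {suc N} f (suc m) = f Fin.zero xor prefixXor (λ i → f (Fin.suc i)) m

prefixXor-suc : ∀ {N} (f : Fin N → Bool) (j : Fin N) →
  prefixXor f (suc (toℕ j)) ≡ prefixXor f (toℕ j) xor f j
prefixXor-suc         f Fin.zero    = xor-identityʳ (f Fin.zero)
prefixXor-suc {suc N} f (Fin.suc j) = begin
  f₀ xor prefixXor f₊ (suc (toℕ j))    ≡⟨ cong (f₀ xor_) (prefixXor-suc f₊ j) ⟩
  f₀ xor (prefixXor f₊ (toℕ j) xor f₊ j) ≡⟨ xor-assoc f₀ _ _ ⟨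
  (f₀ xor prefixXor f₊ (toℕ j)) xor f₊ j ∎
  where
  f₀ : Bool
  f₀ = f Fin.zero
  f₊ : Fin N → Bool
  f₊ = λ i → f (Fin.suc i)

prefixXor-all : ∀ {N} (f : Fin N → Bool) → prefixXor f N ≡ odd (countTrue f)
prefixXor-all {zero}  f = refl
prefixXor-all {suc N} f with f Fin.zero
... | true  = cong not (prefixXor-all (λ i → f (Fin.suc i)))
... | false = prefixXor-all (λ i → f (Fin.suc i))

prefixXor-all-cong-%2 : ∀ {N} (f g : Fin N → Bool) →
  countTrue f % 2 ≡ countTrue g % 2 → prefixXor f N ≡ prefixXor g N
prefixXor-all-cong-%2 f g eq =
  trans (prefixXor-all f)
        (trans (odd-cong-%2 (countTrue f) (countTrue g) eq) (sym (prefixXor-all g)))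

-- Arc G k O is the union of these over all edges, paths and arc indices.
ArcOn : ∀ {V : Set} → Bool → V → V → V → V → Set
ArcOn o u v x y = (o ≡ true × x ≡ u × y ≡ v) ⊎ (o ≡ false × x ≡ v × y ≡ u)

push-ArcOn : ∀ {V : Set} (S : V → Bool) {o₁ o₂ : Bool} {u v : V} →
  o₂ ≡ o₁ xor (S u xor S v) → ∀ x y → ArcOn o₂ u v x y ⇔ Push S (ArcOn o₁ u v) x y
push-ArcOn S {o₁} {o₂} {u} {v} o₂≡ x y = mk⇔ to from
  where
  kept : S u ≡ S v → o₂ ≡ o₁
  kept Su≡Sv = begin
    o₂                   ≡⟨ o₂≡ ⟩
    o₁ xor (S u xor S v) ≡⟨ cong (λ s → o₁ xor (s xor S v)) Su≡Sv ⟩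
    o₁ xor (S v xor S v) ≡⟨ cong (o₁ xor_) (xor-same (S v)) ⟩
    o₁ xor false         ≡⟨ xor-identityʳ o₁ ⟩
    o₁                   ∎

  flipped : S u ≢ S v → o₂ ≡ not o₁
  flipped Su≢Sv = begin
    o₂                   ≡⟨ o₂≡ ⟩
    o₁ xor (S u xor S v) ≡⟨ cong (o₁ xor_) (xor-≢ Su≢Sv) ⟩
    o₁ xor true          ≡⟨ xor-comm o₁ true ⟩
    not o₁               ∎

  to : ArcOn o₂ u v x y → Push S (ArcOn o₁ u v) x y
  to (inj₁ (o₂≡t , refl , refl)) with S u ≟ S v
  ... | yes Su≡Sv = inj₁ (Su≡Sv , inj₁ (trans (sym (kept Su≡Sv)) o₂≡t , refl , refl))
  ... | no  Su≢Sv =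
    inj₂ (Su≢Sv , inj₂ (not-injective (trans (sym (flipped Su≢Sv)) o₂≡t) , refl , refl))
  to (inj₂ (o₂≡f , refl , refl)) with S v ≟ S u
  ... | yes Sv≡Su = inj₁ (Sv≡Su , inj₂ (trans (sym (kept (sym Sv≡Su))) o₂≡f , refl , refl))
  ... | no  Sv≢Su =
    inj₂ (Sv≢Su , inj₁ (not-injective (trans (sym (flipped (≢-sym Sv≢Su))) o₂≡f) , refl , refl))

  from : Push S (ArcOn o₁ u v) x y → ArcOn o₂ u v x y
  from (inj₁ (Su≡Sv , inj₁ (o₁≡t , refl , refl))) = inj₁ (trans (kept Su≡Sv) o₁≡t , refl , refl)
  from (inj₁ (Sv≡Su , inj₂ (o₁≡f , refl , refl))) =
    inj₂ (trans (kept (sym Sv≡Su)) o₁≡f , refl , refl)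
  from (inj₂ (Sv≢Su , inj₁ (o₁≡t , refl , refl))) =
    inj₂ (trans (flipped (≢-sym Sv≢Su)) (cong not o₁≡t) , refl , refl)
  from (inj₂ (Su≢Sv , inj₂ (o₁≡f , refl , refl))) =
    inj₁ (trans (flipped Su≢Sv) (cong not o₁≡f) , refl , refl)

push-Σ : ∀ {V I : Set} (S : V → Bool) {A B : I → V → V → Set} →
  (∀ i x y → B i x y ⇔ Push S (A i) x y) →
  ∀ x y → Σ I (λ i → B i x y) ⇔ Push S (λ x′ y′ → Σ I (λ i → A i x′ y′)) x y
push-Σ S {A} {B} B⇔pushA x y = mk⇔ to from
  where
  to : Σ _ (λ i → B _ x y) → Push S (λ x′ y′ → Σ _ (λ i → A i x′ y′)) x y
  to (i , b) with Equivalence.to (B⇔pushA i x y) b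
  ... | inj₁ (Sx≡Sy , a) = inj₁ (Sx≡Sy , i , a)
  ... | inj₂ (Sx≢Sy , a) = inj₂ (Sx≢Sy , i , a)

  from : Push S (λ x′ y′ → Σ _ (λ i → A i x′ y′)) x y → Σ _ (λ i → B _ x y)
  from (inj₁ (Sx≡Sy , i , a)) = i , Equivalence.from (B⇔pushA i x y) (inj₁ (Sx≡Sy , a))
  from (inj₂ (Sx≢Sy , i , a)) = i , Equivalence.from (B⇔pushA i x y) (inj₂ (Sx≢Sy , a))

≤∧≮pred⇒≡ : ∀ {i K} → suc i ≤ K → ¬ (i < K ∸ 1) → suc i ≡ K
≤∧≮pred⇒≡ {K = suc K} 1+i≤K i≮K = ≤-antisym 1+i≤K (s≤s (≮⇒≥ i≮K))

module _ {n : ℕ} (G : SimpleGraph n) (k : ℕ) (O₁ O₂ : Orientation G k)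
  (same-parity : ∀ e p → countTrue (O₁ e p) % 2 ≡ countTrue (O₂ e p) % 2) where

  disagreement : Edge G → Bool → ℕ → Bool
  disagreement e p m = prefixXor (O₁ e p) m xor prefixXor (O₂ e p) m

  pushed : Vtx G k → Bool
  pushed (inj₁ _)           = false
  pushed (inj₂ (e , p , i)) = disagreement e p (suc (toℕ i))

  disagreement-end : ∀ e p → disagreement e p (4 * k) ≡ false
  disagreement-end e p =
    trans (cong (_xor prefixXor (O₂ e p) (4 * k))
                (prefixXor-all-cong-%2 (O₁ e p) (O₂ e p) (same-parity e p)))
          (xor-same (prefixXor (O₂ e p) (4 * k)))

  pushed-pos : ∀ e p m → m ≤ 4 * k → pushed (pos G k e p m) ≡ disagreement e p m
  pushed-pos e p zero    _ = refl
  pushed-pos e p (suc i) 1+i≤4k with i <? 4 * k ∸ 1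
  ... | yes i<L = cong (λ j → disagreement e p (suc j)) (toℕ-fromℕ< i<L)
  ... | no  i≮L rewrite ≤∧≮pred⇒≡ 1+i≤4k i≮L = sym (disagreement-end e p)

  disagreement-suc : ∀ e p (j : Fin (4 * k)) →
    disagreement e p (suc (toℕ j)) ≡ disagreement e p (toℕ j) xor (O₁ e p j xor O₂ e p j)
  disagreement-suc e p j = begin
    prefixXor f (suc (toℕ j)) xor prefixXor g (suc (toℕ j))
      ≡⟨ cong₂ _xor_ (prefixXor-suc f j) (prefixXor-suc g j) ⟩
    (a xor f j) xor (b xor g j)
      ≡⟨ xor-interchange a (f j) b (g j) ⟩
    (a xor b) xor (f j xor g j) ∎
    where
    f g : Fin (4 * k) → Bool
    f = O₁ e p
    g = O₂ e p
    a b : Bool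
    a = prefixXor f (toℕ j)
    b = prefixXor g (toℕ j)

  O₂-via-pushed : ∀ e p (j : Fin (4 * k)) →
    O₂ e p j ≡ O₁ e p j xor (pushed (pos G k e p (toℕ j)) xor pushed (pos G k e p (suc (toℕ j))))
  O₂-via-pushed e p j = sym (begin
    o₁ xor (pushed (pos G k e p (toℕ j)) xor pushed (pos G k e p (suc (toℕ j))))
      ≡⟨ cong₂ (λ s t → o₁ xor (s xor t))
               (pushed-pos e p (toℕ j) (toℕ≤n j)) (pushed-pos e p (suc (toℕ j)) (toℕ<n j)) ⟩
    o₁ xor (d xor disagreement e p (suc (toℕ j)))
      ≡⟨ cong (λ s → o₁ xor (d xor s)) (disagreement-suc e p j) ⟩
    o₁ xor (d xor (d xor (o₁ xor o₂)))
      ≡⟨ cong (o₁ xor_) (xor-cancelˡ d (o₁ xor o₂)) ⟩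
    o₁ xor (o₁ xor o₂)
      ≡⟨ xor-cancelˡ o₁ o₂ ⟩
    o₂ ∎)
    where
    o₁ o₂ d : Bool
    o₁ = O₁ e p j
    o₂ = O₂ e p j
    d  = disagreement e p (toℕ j)

  pushEquivalent-of-same-parity : PushEquivalent (Arc G k O₁) (Arc G k O₂)
  pushEquivalent-of-same-parity = pushed , push-Σ pushed (λ e → push-Σ pushed (λ p →
    push-Σ pushed (λ j → push-ArcOn pushed (O₂-via-pushed e p j))))

mainTheorem11 : ∀ {n : ℕ} (G : SimpleGraph n) (k : ℕ) → 1 ≤ k →
    (O₁ O₂ : Orientation G k) → IsConstruction G k O₁ → IsConstruction G k O₂ →
    PushEquivalent (Arc G k O₁) (Arc G k O₂)
mainTheorem11 G k _ O₁ O₂ H₁ H₂ = pushEquivalent-of-same-parity G k O₁ O₂ same-parity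
  where
  same-parity : ∀ e p → countTrue (O₁ e p) % 2 ≡ countTrue (O₂ e p) % 2
  same-parity e false = trans (proj₁ (H₁ e)) (sym (proj₁ (H₂ e)))
  same-parity e true  = trans (proj₂ (H₁ e)) (sym (proj₂ (H₂ e)))
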